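{- Let $q$ be a power of $2$, $n\ge 1$, and let $W$ be an $n$-dimensional Wild subspace over ${\rm GF}(q)$. If $f,g\in W$ with $f\neq g$, then $f(1)\neq g(1)$.
   Context: Let $q$ be even and let $\mathfrak F$ be the set of all functions $f:{\rm GF}(q^n)\to{\rm GF}(q^n)$ with $f(0)=0$, a vector space over ${\rm GF}(q)$ (and over ${\rm GF}(q^n)$). A function $f\in\mathfrak F$ is an o-permutation over ${\rm GF}(q^n)$ if $f$ is a permutation of ${\rm GF}(q^n)$ and, for every $s\in{\rm GF}(q^n)$, the map $x\mapsto (f(x+s)+f(s))/x$ is a permutation of ${\rm GF}(q^n)\setminus\{0\}$; an o-polynomial is an o-permutation with $f(1)=1$. An $n$-dimensional Wild subspace over ${\rm GF}(q)$ is an $n$-dimensional ${\rm GF}(q)$-subspace $W$ of $\mathfrak F$ every nonzero element of which is an o-permutation over ${\rm GF}(q^n)$. -}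

module Defs where

open import Level using (0ℓ)
open import Algebra.Bundles using (CommutativeRing)
open import Data.Nat using (ℕ)
import Data.Nat as ℕ
open import Data.Fin using (Fin)
import Data.Fin as Fin
open import Data.Product using (Σ; _×_; _,_; ∃)
open import Function using (_∘_; _⇔_)
open import Relation.Nullary using (¬_)
open import Data.Unit using (⊤)
open import Relation.Binary.PropositionalEquality using (_≡_)

record Field : Set₁ where
  field
    commRing  : CommutativeRing 0ℓ 0ℓ
  open CommutativeRing commRing public
  field
    _⁻¹       : Carrier → Carrier
    0≉1       : ¬ (0# ≈ 1#)
    ⁻¹-inverse : ∀ x → ¬ (x ≈ 0#) → (x * (x ⁻¹)) ≈ 1#

module FieldDefs (F : Field) where
  open Field F hiding (zero)

  sumF : ∀ {n} → (Fin n → Carrier) → Carrier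
  sumF {ℕ.zero}  v = 0#
  sumF {ℕ.suc n} v = v Fin.zero + sumF (v ∘ Fin.suc)

  HasSize : (Carrier → Set) → ℕ → Set
  HasSize P N = Σ (Fin N → Carrier) λ e →
      (∀ i → P (e i))
    × (∀ i j → e i ≈ e j → i ≡ j)
    × (∀ x → P x → ∃ λ i → e i ≈ x)

  FieldSize : ℕ → Set
  FieldSize N = HasSize (λ _ → ⊤) N

  record IsSubfield (K : Carrier → Set) : Set where
    field
      K-resp : ∀ {x y} → x ≈ y → K x → K y
      K-0    : K 0#
      K-1    : K 1#
      K-+    : ∀ {x y} → K x → K y → K (x + y)
      K-*    : ∀ {x y} → K x → K y → K (x * y)
      K-neg  : ∀ {x} → K x → K (- x)
      K-inv  : ∀ {x} → K x → ¬ (x ≈ 0#) → K (x ⁻¹)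

  In𝔉 : (Carrier → Carrier) → Set
  In𝔉 f = (∀ {x y} → x ≈ y → f x ≈ f y) × (f 0# ≈ 0#)

  _≐_ : (Carrier → Carrier) → (Carrier → Carrier) → Set
  f ≐ g = ∀ x → f x ≈ g x

  zeroFun : Carrier → Carrier
  zeroFun _ = 0#

  IsPermutation : (Carrier → Carrier) → Set
  IsPermutation f = (∀ x y → f x ≈ f y → x ≈ y) × (∀ y → ∃ λ x → f x ≈ y)

  IsPermutationNonzero : (Carrier → Carrier) → Set
  IsPermutationNonzero h =
      (∀ x → ¬ (x ≈ 0#) → ¬ (h x ≈ 0#))
    × (∀ x y → ¬ (x ≈ 0#) → ¬ (y ≈ 0#) → h x ≈ h y → x ≈ y)
    × (∀ y → ¬ (y ≈ 0#) → ∃ λ x → ¬ (x ≈ 0#) × (h x ≈ y))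

  IsOPermutation : (Carrier → Carrier) → Set
  IsOPermutation f = IsPermutation f
    × (∀ s → IsPermutationNonzero (λ x → (f (x + s) + f s) * (x ⁻¹)))

  linComb : ∀ {n} → (Fin n → Carrier) → (Fin n → Carrier → Carrier) → Carrier → Carrier
  linComb c b x = sumF (λ i → c i * b i x)

  record IsNDimSubspace (K : Carrier → Set) (W : (Carrier → Carrier) → Set) (n : ℕ) : Set where
    field
      basis       : Fin n → Carrier → Carrier
      basis-in-𝔉  : ∀ i → In𝔉 (basis i)
      independent : ∀ (c : Fin n → Carrier) → (∀ i → K (c i)) →
                    linComb c basis ≐ zeroFun → ∀ i → c i ≈ 0#
      spans       : ∀ f → W f ⇔ (∃ λ (c : Fin n → Carrier) → (∀ i → K (c i)) × (f ≐ linComb c basis))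

  IsWild : (K : Carrier → Set) → (W : (Carrier → Carrier) → Set) → ℕ → Set
  IsWild K W n = IsNDimSubspace K W n
    × (∀ f → W f → ¬ (f ≐ zeroFun) → IsOPermutation f)

-- The difference f − g lies in W and is not identically zero, so it is an
-- o-permutation and in particular injective. Every element of W vanishes at 0,
-- hence f − g cannot vanish at 1.
{-# OPTIONS --safe #-}
module Submission where

open import Defs
open import Data.Nat using (ℕ; zero; suc; _^_; _≥_)
open import Data.Fin using (Fin)
import Data.Fin as Fin
open import Data.Product using (∃; _×_; _,_; proj₁; proj₂)
open import Function using (_∘_; Equivalence)
open import Relation.Binary.PropositionalEquality using (_≡_)
open import Relation.Nullary using (¬_)

module _ (F : Field) where
  open Field F hiding (zero)
  open FieldDefs F
  open import Algebra.Properties.AbelianGroup +-abelianGroup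
    using (⁻¹-∙-comm; x∙y⁻¹≈ε⇒x≈y; x≈y⇒x∙y⁻¹≈ε)
  open import Algebra.Properties.CommutativeSemigroup +-commutativeSemigroup
    using (interchange)
  open import Algebra.Properties.Ring ring using ([y-z]x≈yx-zx)
  open import Relation.Binary.Reasoning.Setoid setoid

  sumF-cong : ∀ {n} {u v : Fin n → Carrier} → (∀ i → u i ≈ v i) → sumF u ≈ sumF v
  sumF-cong {zero}  _   = refl
  sumF-cong {suc n} u≈v = +-cong (u≈v Fin.zero) (sumF-cong (u≈v ∘ Fin.suc))

  sumF-≈0 : ∀ {n} {v : Fin n → Carrier} → (∀ i → v i ≈ 0#) → sumF v ≈ 0#
  sumF-≈0 {zero}  _    = refl
  sumF-≈0 {suc n} v≈0 =
    trans (+-cong (v≈0 Fin.zero) (sumF-≈0 (v≈0 ∘ Fin.suc))) (+-identityˡ 0#)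

  sumF-sub : ∀ {n} (u v : Fin n → Carrier) → sumF (λ i → u i - v i) ≈ sumF u - sumF v
  sumF-sub {zero}  u v = sym (-‿inverseʳ 0#)
  sumF-sub {suc n} u v = begin
    (u₀ - v₀) + sumF (λ i → u′ i - v′ i)  ≈⟨ +-congˡ (sumF-sub u′ v′) ⟩
    (u₀ - v₀) + (sumF u′ - sumF v′)       ≈⟨ interchange u₀ (- v₀) (sumF u′) (- sumF v′) ⟩
    (u₀ + sumF u′) + (- v₀ - sumF v′)     ≈⟨ +-congˡ (⁻¹-∙-comm v₀ (sumF v′)) ⟩
    (u₀ + sumF u′) - (v₀ + sumF v′)       ∎
    where
    u₀ = u Fin.zero
    v₀ = v Fin.zero
    u′ = u ∘ Fin.suc
    v′ = v ∘ Fin.suc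

  linComb-sub : ∀ {n} (c d : Fin n → Carrier) (b : Fin n → Carrier → Carrier) x →
                linComb (λ i → c i - d i) b x ≈ linComb c b x - linComb d b x
  linComb-sub c d b x =
    trans (sumF-cong (λ i → [y-z]x≈yx-zx (b i x) (c i) (d i)))
          (sumF-sub (λ i → c i * b i x) (λ i → d i * b i x))

  linComb-0 : ∀ {n} (c : Fin n → Carrier) {b : Fin n → Carrier → Carrier} →
              (∀ i → In𝔉 (b i)) → linComb c b 0# ≈ 0#
  linComb-0 c b∈𝔉 = sumF-≈0 (λ i → trans (*-congˡ (proj₂ (b∈𝔉 i))) (zeroʳ (c i)))

  module _ {K : Carrier → Set} {W : (Carrier → Carrier) → Set} {n : ℕ}
           (W-subspace : IsNDimSubspace K W n) where
    open IsNDimSubspace W-subspace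

    subspace-0 : ∀ {f} → W f → f 0# ≈ 0#
    subspace-0 {f} Wf with Equivalence.to (spans f) Wf
    ... | c , _ , f≐ = trans (f≐ 0#) (linComb-0 c basis-in-𝔉)

    subspace-sub : IsSubfield K → ∀ {f g} → W f → W g → W (λ x → f x - g x)
    subspace-sub sub {f} {g} Wf Wg
      with Equivalence.to (spans f) Wf | Equivalence.to (spans g) Wg
    ... | c , Kc , f≐ | d , Kd , g≐ =
      Equivalence.from (spans _)
        ( (λ i → c i - d i)
        , (λ i → K-+ (Kc i) (K-neg (Kd i)))
        , λ x → trans (+-cong (f≐ x) (-‿cong (g≐ x))) (sym (linComb-sub c d basis x)))
      where open IsSubfield sub

  permutation-fixing-0-nonzero : ∀ {h} → IsPermutation h → h 0# ≈ 0# →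
                                 ∀ {x} → ¬ (x ≈ 0#) → ¬ (h x ≈ 0#)
  permutation-fixing-0-nonzero (h-injective , _) h0≈0 x≉0 hx≈0 =
    x≉0 (h-injective _ _ (trans hx≈0 (sym h0≈0)))

  wild-separates-nonzero : ∀ {K W n} → IsSubfield K → IsWild K W n →
                           ∀ {f g} → W f → W g → ¬ (f ≐ g) →
                           ∀ {x} → ¬ (x ≈ 0#) → ¬ (f x ≈ g x)
  wild-separates-nonzero {W = W} sub (W-subspace , wild) {f} {g} Wf Wg f≉g x≉0 fx≈gx =
    permutation-fixing-0-nonzero (proj₁ (wild d Wd d≉0)) (subspace-0 W-subspace Wd)
      x≉0 (x≈y⇒x∙y⁻¹≈ε fx≈gx)
    where
    d : Carrier → Carrier
    d x = f x - g x
    Wd : W d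
    Wd = subspace-sub W-subspace sub Wf Wg
    d≉0 : ¬ (d ≐ zeroFun)
    d≉0 d≐0 = f≉g (λ x → x∙y⁻¹≈ε⇒x≈y (f x) (g x) (d≐0 x))

lemma1 : ∀ (F : Field) (q n : ℕ) → (∃ λ k → k ≥ 1 × q ≡ 2 ^ k) → n ≥ 1 →
    FieldDefs.FieldSize F (q ^ n) →
    (K : Field.Carrier F → Set) → FieldDefs.IsSubfield F K → FieldDefs.HasSize F K q →
    (W : (Field.Carrier F → Field.Carrier F) → Set) → FieldDefs.IsWild F K W n →
    ∀ f g → W f → W g → ¬ (FieldDefs._≐_ F f g) →
    ¬ (Field._≈_ F (f (Field.1# F)) (g (Field.1# F)))
lemma1 F q n _ _ _ K sub _ W wild f g Wf Wg f≉g =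
  wild-separates-nonzero F sub wild Wf Wg f≉g (λ 1≈0 → 0≉1 (sym 1≈0))
  where open Field F using (0≉1; sym)
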